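{- Let $\mathcal{C}$ be a $(v_r,b_k)$ configuration with $r>2$ (and $k\ge 2$, $v\ge 4$, $b\ge 4$). Then the Levi graph of $\mathcal{C}$ has at least $v+b+2$ distinct maximal independent sets.
   Context: A configuration is an incidence structure consisting of a set of points and a set of lines together with an incidence relation between points and lines, such that any two distinct points are incident with at most one common line and any two distinct lines are incident with at most one common point. A $(v_r,b_k)$ configuration is a configuration with exactly $v\ge 4$ points and exactly $b\ge 4$ lines, in which every line is incident with exactly $k\ge 2$ points and every point is incident with exactly $r\ge 2$ lines. The Levi graph of a configuration is the simple bipartite graph whose vertex set is the disjoint union of the points and the lines, with a point-vertex $P$ adjacent to a line-vertex $\ell$ iff $P$ is incident with $\ell$, and no other edges. A maximal independent set is an independent set of vertices not properly contained in any other independent set. -}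

module Defs where

open import Data.Nat using (ℕ; _≥_; _>_; _+_)
open import Data.Fin using (Fin)
open import Data.Fin.Subset using (∣_∣)
open import Data.Vec using (tabulate)
open import Data.Bool using (Bool; true; false)
open import Data.Sum using (_⊎_; inj₁; inj₂)
open import Data.Product using (Σ; ∃; _×_)
open import Data.Empty using (⊥)
open import Relation.Binary.PropositionalEquality using (_≡_; _≢_)

Incidence : ℕ → ℕ → Set
Incidence v b = Fin v → Fin b → Bool

pointDeg : ∀ {v b} → Incidence v b → Fin v → ℕ
pointDeg inc p = ∣ tabulate (λ l → inc p l) ∣

lineDeg : ∀ {v b} → Incidence v b → Fin b → ℕ
lineDeg inc l = ∣ tabulate (λ p → inc p l) ∣

IsConfiguration : ∀ {v b} → Incidence v b → Set
IsConfiguration {v} {b} inc =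
  (∀ (p q : Fin v) (l m : Fin b) → p ≢ q →
     inc p l ≡ true → inc q l ≡ true → inc p m ≡ true → inc q m ≡ true → l ≡ m)
  × (∀ (l m : Fin b) (p q : Fin v) → l ≢ m →
     inc p l ≡ true → inc p m ≡ true → inc q l ≡ true → inc q m ≡ true → p ≡ q)

IsVRBKConfiguration : (v r b k : ℕ) → Incidence v b → Set
IsVRBKConfiguration v r b k inc =
  IsConfiguration inc
  × v ≥ 4 × b ≥ 4 × k ≥ 2 × r ≥ 2
  × (∀ l → lineDeg inc l ≡ k)
  × (∀ p → pointDeg inc p ≡ r)

LeviVertex : ℕ → ℕ → Set
LeviVertex v b = Fin v ⊎ Fin b

LeviAdj : ∀ {v b} → Incidence v b → LeviVertex v b → LeviVertex v b → Set
LeviAdj inc (inj₁ p) (inj₂ l) = inc p l ≡ true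
LeviAdj inc (inj₂ l) (inj₁ p) = inc p l ≡ true
LeviAdj inc (inj₁ _) (inj₁ _) = ⊥
LeviAdj inc (inj₂ _) (inj₂ _) = ⊥

VSet : ℕ → ℕ → Set
VSet v b = LeviVertex v b → Bool

_⊆V_ : ∀ {v b} → VSet v b → VSet v b → Set
S ⊆V T = ∀ x → S x ≡ true → T x ≡ true

Independent : ∀ {v b} → Incidence v b → VSet v b → Set
Independent inc S = ∀ x y → S x ≡ true → S y ≡ true → LeviAdj inc x y → ⊥

MaximalIndependent : ∀ {v b} → Incidence v b → VSet v b → Set
MaximalIndependent inc S =
  Independent inc S × (∀ T → Independent inc T → S ⊆V T → T ⊆V S)

DistinctSets : ∀ {v b} → VSet v b → VSet v b → Set
DistinctSets {v} {b} S T = ∃ λ (x : LeviVertex v b) → S x ≢ T x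

-- Besides the set of all points and the set of all lines, take for each point p the
-- set {p} ∪ {lines missing p}, and dually for each line. Such a set is maximal because
-- every vertex outside it has a neighbour inside: a point q ≠ p lies on r ≥ 2 lines, at
-- most one of which passes through p. When r ≥ 3 a line through q missing p remains even
-- after excluding a prescribed line l; it separates the set of p from the set of l.
module Submission where

open import Defs
open import Data.Nat using (ℕ; suc; _+_; _≤_; _<_; _>_; z≤n; s≤s)
open import Data.Nat.Properties
  using (≤-refl; ≤-reflexive; ≤-trans; ≤-<-trans; <⇒≱; +-suc; +-monoʳ-≤; n≤1+n)
open import Data.Fin using (Fin; zero; suc; _≟_; fromℕ<)
open import Data.Fin.Properties using (any?; +↔⊎)
open import Data.Fin.Subset using (Subset; _∈_; _∉_; ⁅_⁆; _∪_; ∣_∣; ⊥)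
open import Data.Fin.Subset.Properties
  using (_∈?_; x∈⁅x⁆; x∈p∪q⁺; p⊆q⇒∣p∣≤∣q∣; ∣⁅x⁆∣≡1; ∣⊥∣≡0; ∣p∣≤∣x∷p∣)
open import Data.Vec using (_∷_; []; tabulate)
open import Data.Vec.Properties using ([]=⇒lookup; lookup∘tabulate)
open import Data.Bool using (Bool; true; false; not)
open import Data.Bool.Properties using (not-injective)
open import Data.Sum using (_⊎_; inj₁; inj₂)
open import Data.Sum.Function.Propositional using (_⊎-↔_)
open import Data.Product using (Σ; ∃; _×_; _,_)
open import Function using (_∘_)
open import Function.Bundles using (Injection; _↣_)
open import Function.Properties.Inverse using (↔-refl; ↔-trans; Inverse⇒Injection)
open import Relation.Nullary using (Dec; yes; no; ¬_; does; contradiction)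
open import Relation.Nullary.Decidable using (_×-dec_; ¬?; dec-true; dec-false; decidable-stable)
open import Relation.Binary.PropositionalEquality using (_≡_; _≢_; refl; sym; trans; cong; subst)

does-true⇒ : ∀ {a} {A : Set a} (a? : Dec A) → does a? ≡ true → A
does-true⇒ (yes a) _ = a

does-false⇒¬ : ∀ {a} {A : Set a} (a? : Dec A) → does a? ≡ false → ¬ A
does-false⇒¬ (no ¬a) _ = ¬a

not≡true⇒≢true : ∀ {x} → not x ≡ true → x ≢ true
not≡true⇒≢true {false} _ ()

∉⁅y⁆⇒≢ : ∀ {n} {x y : Fin n} → x ∉ ⁅ y ⁆ → x ≢ y
∉⁅y⁆⇒≢ x∉ refl = x∉ (x∈⁅x⁆ _)

∣p∪q∣≤∣p∣+∣q∣ : ∀ {n} (p q : Subset n) → ∣ p ∪ q ∣ ≤ ∣ p ∣ + ∣ q ∣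
∣p∪q∣≤∣p∣+∣q∣ []          []          = ≤-refl
∣p∪q∣≤∣p∣+∣q∣ (true ∷ p)  (t ∷ q)     =
  s≤s (≤-trans (∣p∪q∣≤∣p∣+∣q∣ p q) (+-monoʳ-≤ ∣ p ∣ (∣p∣≤∣x∷p∣ t q)))
∣p∪q∣≤∣p∣+∣q∣ (false ∷ p) (true ∷ q)  =
  subst (∣ p ∪ q ∣ <_) (sym (+-suc ∣ p ∣ ∣ q ∣)) (s≤s (∣p∪q∣≤∣p∣+∣q∣ p q))
∣p∪q∣≤∣p∣+∣q∣ (false ∷ p) (false ∷ q) = ∣p∪q∣≤∣p∣+∣q∣ p q

∣q∣<∣p∣⇒∃∈p∉q : ∀ {n} (p q : Subset n) → ∣ q ∣ < ∣ p ∣ → ∃ λ x → x ∈ p × x ∉ q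
∣q∣<∣p∣⇒∃∈p∉q p q ∣q∣<∣p∣ with any? (λ x → x ∈? p ×-dec ¬? (x ∈? q))
... | yes found = found
... | no none   = contradiction (p⊆q⇒∣p∣≤∣q∣ p⊆q) (λ ∣p∣≤∣q∣ → <⇒≱ ∣q∣<∣p∣ ∣p∣≤∣q∣)
  where
  p⊆q : ∀ {x} → x ∈ p → x ∈ q
  p⊆q {x} x∈p = decidable-stable (x ∈? q) (λ x∉q → none (x , x∈p , x∉q))

∈-tabulate⁻ : ∀ {n} {f : Fin n → Bool} {x} → x ∈ tabulate f → f x ≡ true
∈-tabulate⁻ {f = f} {x} x∈ = trans (sym (lookup∘tabulate f x)) ([]=⇒lookup x∈)

∃-true : ∀ {n} (f : Fin n → Bool) → 0 < ∣ tabulate f ∣ → ∃ λ x → f x ≡ true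
∃-true {n} f ∣f∣>0
  with ∣q∣<∣p∣⇒∃∈p∉q (tabulate f) ⊥ (subst (_< ∣ tabulate f ∣) (sym (∣⊥∣≡0 n)) ∣f∣>0)
... | x , x∈f , _ = x , ∈-tabulate⁻ x∈f

∃-true-≢ : ∀ {n} (f : Fin n → Bool) y → 1 < ∣ tabulate f ∣ → ∃ λ x → f x ≡ true × x ≢ y
∃-true-≢ f y ∣f∣>1
  with ∣q∣<∣p∣⇒∃∈p∉q (tabulate f) ⁅ y ⁆ (subst (_< ∣ tabulate f ∣) (sym (∣⁅x⁆∣≡1 y)) ∣f∣>1)
... | x , x∈f , x∉⁅y⁆ = x , ∈-tabulate⁻ x∈f , ∉⁅y⁆⇒≢ x∉⁅y⁆

transpose : ∀ {v b} → Incidence v b → Incidence b v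
transpose inc l p = inc p l

RowsMeetOnce : ∀ {v b} → Incidence v b → Set
RowsMeetOnce {v} {b} inc = ∀ (p q : Fin v) (l m : Fin b) → p ≢ q →
  inc p l ≡ true → inc q l ≡ true → inc p m ≡ true → inc q m ≡ true → l ≡ m

module _ {v b} {inc : Incidence v b} (meetOnce : RowsMeetOnce inc) where

  separatingLine : ∀ {p q} → p ≢ q → (E : Subset b) → suc ∣ E ∣ < pointDeg inc q →
    ∃ λ m → inc q m ≡ true × m ∉ E × inc p m ≡ false
  separatingLine {p} {q} p≢q E room
    with ∣q∣<∣p∣⇒∃∈p∉q (tabulate (inc q)) E (≤-trans (n≤1+n _) room)
  ... | m₁ , q∈m₁ , m₁∉E with inc p m₁ in p∈m₁
  ... | false = m₁ , ∈-tabulate⁻ q∈m₁ , m₁∉E , p∈m₁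
  ... | true with ∣q∣<∣p∣⇒∃∈p∉q (tabulate (inc q)) (⁅ m₁ ⁆ ∪ E) (≤-<-trans ∣⁅m₁⁆∪E∣≤1+∣E∣ room)
    where
    ∣⁅m₁⁆∪E∣≤1+∣E∣ : ∣ ⁅ m₁ ⁆ ∪ E ∣ ≤ suc ∣ E ∣
    ∣⁅m₁⁆∪E∣≤1+∣E∣ = ≤-trans (∣p∪q∣≤∣p∣+∣q∣ ⁅ m₁ ⁆ E) (≤-reflexive (cong (_+ ∣ E ∣) (∣⁅x⁆∣≡1 m₁)))
  ... | m₂ , q∈m₂ , m₂∉⁅m₁⁆∪E with inc p m₂ in p∈m₂
  ... | false = m₂ , ∈-tabulate⁻ q∈m₂ , m₂∉⁅m₁⁆∪E ∘ x∈p∪q⁺ ∘ inj₂ , p∈m₂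
  ... | true = contradiction (x∈p∪q⁺ (inj₁ (subst (_∈ ⁅ m₁ ⁆) m₁≡m₂ (x∈⁅x⁆ m₁)))) m₂∉⁅m₁⁆∪E
    where
    m₁≡m₂ : m₁ ≡ m₂
    m₁≡m₂ = meetOnce p q m₁ m₂ p≢q p∈m₁ (∈-tabulate⁻ q∈m₁) p∈m₂ (∈-tabulate⁻ q∈m₂)

  separatingLine₀ : ∀ {p q} → p ≢ q → 1 < pointDeg inc q →
    ∃ λ m → inc q m ≡ true × inc p m ≡ false
  separatingLine₀ {q = q} p≢q deg>1
    with separatingLine p≢q ⊥ (subst (λ n → suc n < pointDeg inc q) (sym (∣⊥∣≡0 b)) deg>1)
  ... | m , q∈m , _ , p∉m = m , q∈m , p∉m

module _ {v b} {inc : Incidence v b} where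

  FlagFree : VSet v b → Set
  FlagFree S = ∀ p l → S (inj₁ p) ≡ true → S (inj₂ l) ≡ true → inc p l ≢ true

  Dominating : VSet v b → Set
  Dominating S = ∀ x → S x ≡ false → ∃ λ y → S y ≡ true × LeviAdj inc x y

  flagFree⇒independent : ∀ {S} → FlagFree S → Independent inc S
  flagFree⇒independent noFlag (inj₁ p) (inj₂ l) p∈S l∈S = noFlag p l p∈S l∈S
  flagFree⇒independent noFlag (inj₂ l) (inj₁ p) l∈S p∈S = noFlag p l p∈S l∈S
  flagFree⇒independent _      (inj₁ _) (inj₁ _) _   _   ()
  flagFree⇒independent _      (inj₂ _) (inj₂ _) _   _   ()

  independent∧dominating⇒maximal : ∀ {S} → Independent inc S → Dominating S →
    MaximalIndependent inc S
  independent∧dominating⇒maximal {S} indS domS = indS , maximal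
    where
    maximal : ∀ T → Independent inc T → S ⊆V T → T ⊆V S
    maximal T indT S⊆T x x∈T with S x in x∈S?
    ... | true  = refl
    ... | false with domS x x∈S?
    ...   | y , y∈S , x~y = contradiction x~y (indT x y x∈T (S⊆T y y∈S))

distinct-at : ∀ {v b} {S T : VSet v b} x → S x ≡ true → T x ≡ false → DistinctSets S T
distinct-at x x∈S x∉T = x , λ S≡T → contradiction (trans (sym x∈S) (trans S≡T x∉T)) λ ()

DistinctSets-sym : ∀ {v b} {S T : VSet v b} → DistinctSets S T → DistinctSets T S
DistinctSets-sym (x , Sx≢Tx) = x , Sx≢Tx ∘ sym

module _ {v b} (inc : Incidence v b) where

  allPoints : VSet v b
  allPoints (inj₁ _) = true
  allPoints (inj₂ _) = false

  allLines : VSet v b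
  allLines (inj₁ _) = false
  allLines (inj₂ _) = true

  pointWithMissedLines : Fin v → VSet v b
  pointWithMissedLines p (inj₁ q) = does (q ≟ p)
  pointWithMissedLines p (inj₂ l) = not (inc p l)

  lineWithMissedPoints : Fin b → VSet v b
  lineWithMissedPoints l (inj₁ q) = not (inc q l)
  lineWithMissedPoints l (inj₂ m) = does (m ≟ l)

  allPoints-maximal : (∀ l → 0 < lineDeg inc l) → MaximalIndependent inc allPoints
  allPoints-maximal lineDeg>0 = independent∧dominating⇒maximal (flagFree⇒independent noFlag) dom
    where
    noFlag : FlagFree allPoints
    noFlag _ _ _ ()
    dom : Dominating allPoints
    dom (inj₂ l) _ with ∃-true (transpose inc l) (lineDeg>0 l)
    ... | p , p∈l = inj₁ p , refl , p∈l

  allLines-maximal : (∀ p → 0 < pointDeg inc p) → MaximalIndependent inc allLines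
  allLines-maximal pointDeg>0 = independent∧dominating⇒maximal (flagFree⇒independent noFlag) dom
    where
    noFlag : FlagFree allLines
    noFlag _ _ ()
    dom : Dominating allLines
    dom (inj₁ p) _ with ∃-true (inc p) (pointDeg>0 p)
    ... | l , p∈l = inj₂ l , refl , p∈l

  pointWithMissedLines-maximal : RowsMeetOnce inc → (∀ q → 1 < pointDeg inc q) →
    ∀ p → MaximalIndependent inc (pointWithMissedLines p)
  pointWithMissedLines-maximal meetOnce pointDeg>1 p =
    independent∧dominating⇒maximal (flagFree⇒independent noFlag) dom
    where
    noFlag : FlagFree (pointWithMissedLines p)
    noFlag q l q≡p p∉l with does-true⇒ (q ≟ p) q≡p
    ... | refl = not≡true⇒≢true p∉l
    dom : Dominating (pointWithMissedLines p)
    dom (inj₁ q) q≢p with separatingLine₀ meetOnce (does-false⇒¬ (q ≟ p) q≢p ∘ sym) (pointDeg>1 q)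
    ... | m , q∈m , p∉m = inj₂ m , cong not p∉m , q∈m
    dom (inj₂ l) p∈l = inj₁ p , dec-true (p ≟ p) refl , not-injective {y = true} p∈l

  lineWithMissedPoints-maximal : RowsMeetOnce (transpose inc) → (∀ m → 1 < lineDeg inc m) →
    ∀ l → MaximalIndependent inc (lineWithMissedPoints l)
  lineWithMissedPoints-maximal meetOnce lineDeg>1 l =
    independent∧dominating⇒maximal (flagFree⇒independent noFlag) dom
    where
    noFlag : FlagFree (lineWithMissedPoints l)
    noFlag q m q∉l m≡l with does-true⇒ (m ≟ l) m≡l
    ... | refl = not≡true⇒≢true q∉l
    dom : Dominating (lineWithMissedPoints l)
    dom (inj₂ m) m≢l with separatingLine₀ meetOnce (does-false⇒¬ (m ≟ l) m≢l ∘ sym) (lineDeg>1 m)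
    ... | q , q∈m , q∉l = inj₁ q , cong not q∉l , q∈m
    dom (inj₁ q) q∈l = inj₂ l , dec-true (l ≟ l) refl , not-injective {y = true} q∈l

  allPoints≢allLines : Fin v → DistinctSets allPoints allLines
  allPoints≢allLines p = distinct-at (inj₁ p) refl refl

module Configuration {v b} (inc : Incidence v b)
  (twoPointsOneLine : RowsMeetOnce inc) (twoLinesOnePoint : RowsMeetOnce (transpose inc))
  (lineDeg≥2 : ∀ l → 2 ≤ lineDeg inc l) (pointDeg≥3 : ∀ p → 3 ≤ pointDeg inc p) where

  otherPoint : ∀ p → ∃ λ q → q ≢ p
  otherPoint p with ∃-true (inc p) (≤-trans (s≤s z≤n) (pointDeg≥3 p))
  ... | l , _ with ∃-true-≢ (transpose inc l) p (lineDeg≥2 l)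
  ...   | q , _ , q≢p = q , q≢p

  otherLine : ∀ l → ∃ λ m → m ≢ l
  otherLine l with ∃-true (transpose inc l) (≤-trans (s≤s z≤n) (lineDeg≥2 l))
  ... | p , _ with ∃-true-≢ (inc p) l (≤-trans (s≤s (s≤s z≤n)) (pointDeg≥3 p))
  ...   | m , _ , m≢l = m , m≢l

  pointWithMissedLines-distinct : ∀ {p q} → p ≢ q →
    DistinctSets (pointWithMissedLines inc p) (pointWithMissedLines inc q)
  pointWithMissedLines-distinct {p} {q} p≢q =
    distinct-at (inj₁ p) (dec-true (p ≟ p) refl) (dec-false (p ≟ q) p≢q)

  lineWithMissedPoints-distinct : ∀ {l m} → l ≢ m →
    DistinctSets (lineWithMissedPoints inc l) (lineWithMissedPoints inc m)
  lineWithMissedPoints-distinct {l} {m} l≢m =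
    distinct-at (inj₂ l) (dec-true (l ≟ l) refl) (dec-false (l ≟ m) l≢m)

  pointWithMissedLines≢lineWithMissedPoints : ∀ p l →
    DistinctSets (pointWithMissedLines inc p) (lineWithMissedPoints inc l)
  pointWithMissedLines≢lineWithMissedPoints p l with otherPoint p
  ... | q , q≢p with separatingLine twoPointsOneLine (q≢p ∘ sym) ⁅ l ⁆ room
    where
    room : suc ∣ ⁅ l ⁆ ∣ < pointDeg inc q
    room = subst (λ n → suc n < pointDeg inc q) (sym (∣⁅x⁆∣≡1 l)) (pointDeg≥3 q)
  ...   | m , _ , m∉⁅l⁆ , p∉m =
    distinct-at (inj₂ m) (cong not p∉m) (dec-false (m ≟ l) (∉⁅y⁆⇒≢ m∉⁅l⁆))

  allPoints≢pointWithMissedLines : ∀ p → DistinctSets (allPoints inc) (pointWithMissedLines inc p)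
  allPoints≢pointWithMissedLines p with otherPoint p
  ... | q , q≢p = distinct-at (inj₁ q) refl (dec-false (q ≟ p) q≢p)

  pointWithMissedLines≢allLines : ∀ p → DistinctSets (pointWithMissedLines inc p) (allLines inc)
  pointWithMissedLines≢allLines p = distinct-at (inj₁ p) (dec-true (p ≟ p) refl) refl

  allPoints≢lineWithMissedPoints : ∀ l → DistinctSets (allPoints inc) (lineWithMissedPoints inc l)
  allPoints≢lineWithMissedPoints l with ∃-true (transpose inc l) (≤-trans (s≤s z≤n) (lineDeg≥2 l))
  ... | q , q∈l = distinct-at (inj₁ q) refl (cong not q∈l)

  allLines≢lineWithMissedPoints : ∀ l → DistinctSets (allLines inc) (lineWithMissedPoints inc l)
  allLines≢lineWithMissedPoints l with otherLine l
  ... | m , m≢l = distinct-at (inj₂ m) refl (dec-false (m ≟ l) m≢l)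

  Label : Set
  Label = (Fin v ⊎ Fin b) ⊎ Fin 2

  leviFamily : Label → VSet v b
  leviFamily (inj₁ (inj₁ p))   = pointWithMissedLines inc p
  leviFamily (inj₁ (inj₂ l))   = lineWithMissedPoints inc l
  leviFamily (inj₂ zero)       = allPoints inc
  leviFamily (inj₂ (suc zero)) = allLines inc

  leviFamily-maximal : ∀ t → MaximalIndependent inc (leviFamily t)
  leviFamily-maximal (inj₁ (inj₁ p)) =
    pointWithMissedLines-maximal inc twoPointsOneLine (≤-trans (s≤s (s≤s z≤n)) ∘ pointDeg≥3) p
  leviFamily-maximal (inj₁ (inj₂ l)) = lineWithMissedPoints-maximal inc twoLinesOnePoint lineDeg≥2 l
  leviFamily-maximal (inj₂ zero)       = allPoints-maximal inc (≤-trans (s≤s z≤n) ∘ lineDeg≥2)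
  leviFamily-maximal (inj₂ (suc zero)) = allLines-maximal inc (≤-trans (s≤s z≤n) ∘ pointDeg≥3)

  leviFamily-distinct : Fin v → ∀ s t → s ≢ t → DistinctSets (leviFamily s) (leviFamily t)
  leviFamily-distinct _ (inj₁ (inj₁ p)) (inj₁ (inj₁ q)) s≢t =
    pointWithMissedLines-distinct (s≢t ∘ cong (inj₁ ∘ inj₁))
  leviFamily-distinct _ (inj₁ (inj₁ p)) (inj₁ (inj₂ l)) _ = pointWithMissedLines≢lineWithMissedPoints p l
  leviFamily-distinct _ (inj₁ (inj₁ p)) (inj₂ zero) _ = DistinctSets-sym (allPoints≢pointWithMissedLines p)
  leviFamily-distinct _ (inj₁ (inj₁ p)) (inj₂ (suc zero)) _ = pointWithMissedLines≢allLines p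
  leviFamily-distinct _ (inj₁ (inj₂ l)) (inj₁ (inj₁ p)) _ =
    DistinctSets-sym (pointWithMissedLines≢lineWithMissedPoints p l)
  leviFamily-distinct _ (inj₁ (inj₂ l)) (inj₁ (inj₂ m)) s≢t =
    lineWithMissedPoints-distinct (s≢t ∘ cong (inj₁ ∘ inj₂))
  leviFamily-distinct _ (inj₁ (inj₂ l)) (inj₂ zero) _ = DistinctSets-sym (allPoints≢lineWithMissedPoints l)
  leviFamily-distinct _ (inj₁ (inj₂ l)) (inj₂ (suc zero)) _ = DistinctSets-sym (allLines≢lineWithMissedPoints l)
  leviFamily-distinct _ (inj₂ zero) (inj₁ (inj₁ p)) _ = allPoints≢pointWithMissedLines p
  leviFamily-distinct _ (inj₂ zero) (inj₁ (inj₂ l)) _ = allPoints≢lineWithMissedPoints l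
  leviFamily-distinct _ (inj₂ zero) (inj₂ zero) s≢t = contradiction refl s≢t
  leviFamily-distinct p₀ (inj₂ zero) (inj₂ (suc zero)) _ = allPoints≢allLines inc p₀
  leviFamily-distinct _ (inj₂ (suc zero)) (inj₁ (inj₁ p)) _ = DistinctSets-sym (pointWithMissedLines≢allLines p)
  leviFamily-distinct _ (inj₂ (suc zero)) (inj₁ (inj₂ l)) _ = allLines≢lineWithMissedPoints l
  leviFamily-distinct p₀ (inj₂ (suc zero)) (inj₂ zero) _ = DistinctSets-sym (allPoints≢allLines inc p₀)
  leviFamily-distinct _ (inj₂ (suc zero)) (inj₂ (suc zero)) s≢t = contradiction refl s≢t

lemma2p1 : (v r b k : ℕ) (inc : Incidence v b) →
    IsVRBKConfiguration v r b k inc → r > 2 →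
    Σ (Fin (v + b + 2) → VSet v b) λ F →
      (∀ i → MaximalIndependent inc (F i))
      × (∀ i j → i ≢ j → DistinctSets (F i) (F j))
lemma2p1 v r b k inc ((twoPointsOneLine , twoLinesOnePoint) , v≥4 , _ , k≥2 , _ , lineDeg≡k , pointDeg≡r) r>2 =
  leviFamily ∘ label ,
  leviFamily-maximal ∘ label ,
  λ i j i≢j → leviFamily-distinct (fromℕ< v≥4) (label i) (label j) (i≢j ∘ Injection.injective labelling)
  where
  open Configuration inc twoPointsOneLine twoLinesOnePoint
    (λ l → subst (2 ≤_) (sym (lineDeg≡k l)) k≥2) (λ p → subst (3 ≤_) (sym (pointDeg≡r p)) r>2)

  labelling : Fin (v + b + 2) ↣ Label
  labelling = Inverse⇒Injection (↔-trans +↔⊎ (+↔⊎ ⊎-↔ ↔-refl))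

  label : Fin (v + b + 2) → Label
  label = Injection.to labelling
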